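{- For every positive integer $N$, $c(N) \ge 5\left\lceil \frac{N}{4} \right\rceil$.
   Context: A line is a set of 5 consecutive lattice points of $\mathbb{Z}^2$ in one of the four directions: horizontal, vertical, or one of the two diagonals $(1,1)$, $(1,-1)$. A layout of $N$ lines is a collection of $N$ lines such that any two lines of the same direction share no lattice point (as required by the rules of Morpion Solitaire 5D). The lines cover the union of their lattice points. $c(N)$ denotes the minimum, over all layouts of $N$ lines, of the number of lattice points covered by the layout. -}

module Defs where

open import Data.Nat using (ℕ; zero; suc; _+_; _*_; _≤_; _<_)
open import Data.Nat.DivMod using (_/_)
open import Data.Integer as ℤ using (ℤ; +_; -[1+_])
open import Data.Fin using (Fin)
open import Data.Product using (_×_; _,_; proj₁; proj₂)
open import Data.Product.Properties using (≡-dec)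
open import Data.List using (List; []; _∷_; map; concatMap; length; deduplicate; lookup)
open import Data.List.Membership.Propositional using (_∈_)
open import Relation.Binary.PropositionalEquality using (_≡_; _≢_)
open import Relation.Binary.Definitions using (DecidableEquality)
open import Relation.Nullary using (¬_)

Point : Set
Point = ℤ × ℤ

_≟P_ : DecidableEquality Point
_≟P_ = ≡-dec ℤ._≟_ ℤ._≟_

data Dir : Set where
  horiz vert diag antidiag : Dir

step : Dir → Point
step horiz    = (+ 1 , + 0)
step vert     = (+ 0 , + 1)
step diag     = (+ 1 , + 1)
step antidiag = (+ 1 , -[1+ 0 ])

record Line : Set where
  constructor mkLine
  field
    start : Point
    dir   : Dir
open Line public

pointAt : Line → ℕ → Point
pointAt (mkLine (x , y) d) k = (x ℤ.+ (+ k) ℤ.* proj₁ (step d) , y ℤ.+ (+ k) ℤ.* proj₂ (step d))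

linePoints : Line → List Point
linePoints l = pointAt l 0 ∷ pointAt l 1 ∷ pointAt l 2 ∷ pointAt l 3 ∷ pointAt l 4 ∷ []

IsLayout : List Line → Set
IsLayout ls = (i j : Fin (length ls)) → i ≢ j →
  dir (lookup ls i) ≡ dir (lookup ls j) →
  (p : Point) → p ∈ linePoints (lookup ls i) → ¬ (p ∈ linePoints (lookup ls j))

covered : List Line → ℕ
covered ls = length (deduplicate _≟P_ (concatMap linePoints ls))

ceil4 : ℕ → ℕ
ceil4 n = (n + 3) / 4

-- The lines of one direction are pairwise disjoint, so a layout covers at least
-- 5 points per line of any single direction. Among the four directions one
-- carries at least ⌈N/4⌉ of the N lines.
module Submission where

open import Defs
open import Data.Nat using (ℕ; suc; _+_; _*_; _≤_; _<_; s≤s; z≤n)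
open import Data.Nat.Properties
  using (≤-trans; ≤-reflexive; +-mono-≤; +-suc; +-comm; *-comm; *-monoˡ-≤; _≤?_; ≰⇒>; <⇒≱; module ≤-Reasoning)
open import Data.Nat.DivMod using (m/n*n≤m)
open import Data.Nat.Tactic.RingSolver using (solve-∀)
open import Data.Integer as ℤ using (+_)
open import Data.Integer.Properties as ℤₚ using (+-0-abelianGroup; *-identityʳ)
open import Algebra.Properties.AbelianGroup +-0-abelianGroup using (∙-cancelˡ)
open import Data.Product using (_,_; proj₁; proj₂; ∃-syntax)
open import Data.Sum using (inj₁; inj₂)
open import Data.Empty using (⊥-elim)
open import Function using (_on_)
open import Data.List using (List; []; _∷_; _++_; length; filter; concatMap; lookup; deduplicate)
open import Data.List.Properties using (length-++; tabulate-lookup)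
open import Data.List.Membership.Propositional using (_∈_)
open import Data.List.Membership.Propositional.Properties using (∈-∃++; ∈-++⁻; ∈-++⁺ˡ; ∈-++⁺ʳ; ∈-deduplicate⁺)
open import Data.List.Relation.Binary.Subset.Propositional using (_⊆_)
open import Data.List.Relation.Binary.Subset.Propositional.Properties using (filter-⊆; concatMap⁺)
open import Data.List.Relation.Binary.Disjoint.Propositional using (Disjoint)
open import Data.List.Relation.Unary.Any using (here; there)
open import Data.List.Relation.Unary.All as All using (All; []; _∷_)
import Data.List.Relation.Unary.All.Properties as Allₚ
open import Data.List.Relation.Unary.AllPairs using (AllPairs; []; _∷_)
import Data.List.Relation.Unary.AllPairs.Properties as AllPairsₚ
open import Data.List.Relation.Unary.Unique.Propositional using (Unique)
import Data.List.Relation.Unary.Unique.Propositional.Properties as Uniqueₚ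
open import Relation.Binary.Definitions using (DecidableEquality)
open import Relation.Binary.PropositionalEquality using (_≡_; _≢_; refl; sym; trans; cong; cong₂; subst; module ≡-Reasoning)
open import Relation.Nullary using (Dec; yes; no)

private
  variable
    A B : Set

∈-++-∷⁻ : ∀ (as : List A) {bs x y} → y ∈ as ++ x ∷ bs → y ≢ x → y ∈ as ++ bs
∈-++-∷⁻ as y∈ y≢x with ∈-++⁻ as y∈
... | inj₁ y∈as          = ∈-++⁺ˡ y∈as
... | inj₂ (here y≡x)    = ⊥-elim (y≢x y≡x)
... | inj₂ (there y∈bs)  = ∈-++⁺ʳ as y∈bs

unique∧⊆⇒length≤ : {xs ys : List A} → Unique xs → xs ⊆ ys → length xs ≤ length ys
unique∧⊆⇒length≤ {xs = []} _ _ = z≤n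
unique∧⊆⇒length≤ {xs = x ∷ xs} (x∉xs ∷ uxs) xxs⊆ys with ∈-∃++ (xxs⊆ys (here refl))
... | as , bs , refl = begin
  suc (length xs)             ≤⟨ s≤s (unique∧⊆⇒length≤ uxs xs⊆as++bs) ⟩
  suc (length (as ++ bs))     ≡⟨ cong suc (length-++ as) ⟩
  suc (length as + length bs) ≡⟨ +-suc (length as) (length bs) ⟨
  length as + length (x ∷ bs) ≡⟨ length-++ as ⟨
  length (as ++ x ∷ bs)       ∎
  where
  open ≤-Reasoning
  xs⊆as++bs : xs ⊆ as ++ bs
  xs⊆as++bs z∈xs = ∈-++-∷⁻ as (xxs⊆ys (there z∈xs)) (λ z≡x → All.lookup x∉xs z∈xs (sym z≡x))

length-concatMap-const : ∀ (f : A → List B) {k} → (∀ x → length (f x) ≡ k) →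
  ∀ xs → length (concatMap f xs) ≡ length xs * k
length-concatMap-const f fk [] = refl
length-concatMap-const f {k} fk (x ∷ xs) = begin
  length (f x ++ concatMap f xs)         ≡⟨ length-++ (f x) ⟩
  length (f x) + length (concatMap f xs) ≡⟨ cong₂ _+_ (fk x) (length-concatMap-const f fk xs) ⟩
  k + length xs * k                      ∎
  where open ≡-Reasoning

_≟D_ : DecidableEquality Dir
horiz    ≟D horiz    = yes refl
horiz    ≟D vert     = no λ ()
horiz    ≟D diag     = no λ ()
horiz    ≟D antidiag = no λ ()
vert     ≟D horiz    = no λ ()
vert     ≟D vert     = yes refl
vert     ≟D diag     = no λ ()
vert     ≟D antidiag = no λ ()
diag     ≟D horiz    = no λ ()
diag     ≟D vert     = no λ ()
diag     ≟D diag     = yes refl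
diag     ≟D antidiag = no λ ()
antidiag ≟D horiz    = no λ ()
antidiag ≟D vert     = no λ ()
antidiag ≟D diag     = no λ ()
antidiag ≟D antidiag = yes refl

+-*1-injective : ∀ x {k k′} → x ℤ.+ + k ℤ.* + 1 ≡ x ℤ.+ + k′ ℤ.* + 1 → k ≡ k′
+-*1-injective x {k} {k′} eq = ℤₚ.+-injective (begin
  + k          ≡⟨ *-identityʳ (+ k) ⟨
  + k ℤ.* + 1  ≡⟨ ∙-cancelˡ x _ _ eq ⟩
  + k′ ℤ.* + 1 ≡⟨ *-identityʳ (+ k′) ⟩
  + k′         ∎)
  where open ≡-Reasoning

pointAt-injective : ∀ l {k k′} → pointAt l k ≡ pointAt l k′ → k ≡ k′
pointAt-injective (mkLine (x , y) horiz)    eq = +-*1-injective x (cong proj₁ eq)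
pointAt-injective (mkLine (x , y) vert)     eq = +-*1-injective y (cong proj₂ eq)
pointAt-injective (mkLine (x , y) diag)     eq = +-*1-injective x (cong proj₁ eq)
pointAt-injective (mkLine (x , y) antidiag) eq = +-*1-injective x (cong proj₁ eq)

linePoints-unique : ∀ l → Unique (linePoints l)
linePoints-unique l = Uniqueₚ.map⁺ (pointAt-injective l) (Uniqueₚ.upTo⁺ 5)

SameDirDisjoint : Line → Line → Set
SameDirDisjoint l m = dir l ≡ dir m → Disjoint (linePoints l) (linePoints m)

layout⇒allPairs : ∀ ls → IsLayout ls → AllPairs SameDirDisjoint ls
layout⇒allPairs ls lay = subst (AllPairs SameDirDisjoint) (tabulate-lookup ls)
  (AllPairsₚ.tabulate⁺ {f = lookup ls} λ {i} {j} i≢j same (p∈i , p∈j) → lay i j i≢j same _ p∈i p∈j)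

sameDir⇒pairwiseDisjoint : ∀ {d ls} → All (λ l → dir l ≡ d) ls → AllPairs SameDirDisjoint ls →
  AllPairs (Disjoint on linePoints) ls
sameDir⇒pairwiseDisjoint [] [] = []
sameDir⇒pairwiseDisjoint (l≡d ∷ ls≡d) (l~ls ∷ ls~) =
  All.zipWith (λ (disjoint , m≡d) {_} → disjoint (trans l≡d (sym m≡d))) (l~ls , ls≡d)
  ∷ sameDir⇒pairwiseDisjoint ls≡d ls~

inDir? : ∀ d l → Dec (dir l ≡ d)
inDir? d l = dir l ≟D d

linesIn : Dir → List Line → List Line
linesIn d = filter (inDir? d)

count : Dir → List Line → ℕ
count d ls = length (linesIn d ls)

pointsIn-unique : ∀ d ls → IsLayout ls → Unique (concatMap linePoints (linesIn d ls))
pointsIn-unique d ls lay = Uniqueₚ.concat⁺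
  (Allₚ.map⁺ (All.universal linePoints-unique (linesIn d ls)))
  (AllPairsₚ.map⁺ (sameDir⇒pairwiseDisjoint (Allₚ.all-filter (inDir? d) ls)
                                              (AllPairsₚ.filter⁺ (inDir? d) (layout⇒allPairs ls lay))))

count*5≤covered : ∀ d ls → IsLayout ls → count d ls * 5 ≤ covered ls
count*5≤covered d ls lay = begin
  count d ls * 5                              ≡⟨ length-concatMap-const linePoints (λ _ → refl) (linesIn d ls) ⟨
  length (concatMap linePoints (linesIn d ls)) ≤⟨ unique∧⊆⇒length≤ (pointsIn-unique d ls lay) pointsIn⊆covered ⟩
  covered ls                                  ∎
  where
  open ≤-Reasoning
  pointsIn⊆covered : concatMap linePoints (linesIn d ls) ⊆ deduplicate _≟P_ (concatMap linePoints ls)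
  pointsIn⊆covered p∈ = ∈-deduplicate⁺ _≟P_ (concatMap⁺ linePoints (filter-⊆ (inDir? d) ls) p∈)

ceil4-*4-≤ : ∀ n → ceil4 n * 4 ≤ n + 3
ceil4-*4-≤ n = m/n*n≤m (n + 3) 4

Σ-Dir : (Dir → ℕ) → ℕ
Σ-Dir f = f horiz + (f vert + (f diag + f antidiag))

pigeonhole-Dir : ∀ (f : Dir → ℕ) → ∃[ d ] ceil4 (Σ-Dir f) ≤ f d
pigeonhole-Dir f
  with ceil4 (Σ-Dir f) ≤? f horiz | ceil4 (Σ-Dir f) ≤? f vert
     | ceil4 (Σ-Dir f) ≤? f diag  | ceil4 (Σ-Dir f) ≤? f antidiag
... | yes C≤h | _       | _       | _       = horiz , C≤h
... | no _    | yes C≤v | _       | _       = vert , C≤v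
... | no _    | no _    | yes C≤d | _       = diag , C≤d
... | no _    | no _    | no _    | yes C≤a = antidiag , C≤a
... | no C≰h  | no C≰v  | no C≰d  | no C≰a  =
  ⊥-elim (<⇒≱ (s≤s (≤-reflexive (+-comm n 3)))
                (≤-trans (all-below (≰⇒> C≰h) (≰⇒> C≰v) (≰⇒> C≰d) (≰⇒> C≰a)) (ceil4-*4-≤ n)))
  where
  n = Σ-Dir f
  all-below : ∀ {C} → f horiz < C → f vert < C → f diag < C → f antidiag < C → 4 + n ≤ C * 4
  all-below {C} h<C v<C d<C a<C = begin
    4 + n                                                              ≡⟨ move-sucs _ _ _ _ ⟩
    suc (f horiz) + (suc (f vert) + (suc (f diag) + suc (f antidiag))) ≤⟨ +-mono-≤ h<C (+-mono-≤ v<C (+-mono-≤ d<C a<C)) ⟩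
    C + (C + (C + C))                                                  ≡⟨ four-times C ⟩
    C * 4                                                              ∎
    where
    open ≤-Reasoning
    move-sucs : ∀ a b c e → 4 + (a + (b + (c + e))) ≡ suc a + (suc b + (suc c + suc e))
    move-sucs = solve-∀
    four-times : ∀ C → C + (C + (C + C)) ≡ C * 4
    four-times = solve-∀

+-suc₂ : ∀ a b c → a + (b + suc c) ≡ suc (a + (b + c))
+-suc₂ = solve-∀

+-suc₃ : ∀ a b c e → a + (b + (c + suc e)) ≡ suc (a + (b + (c + e)))
+-suc₃ = solve-∀

Σ-Dir-count : ∀ ls → Σ-Dir (λ d → count d ls) ≡ length ls
Σ-Dir-count [] = refl
Σ-Dir-count (l ∷ ls) with dir l | Σ-Dir-count ls
... | horiz    | ih = cong suc ih
... | vert     | ih = trans (+-suc (count horiz ls) _) (cong suc ih)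
... | diag     | ih = trans (+-suc₂ (count horiz ls) (count vert ls) _) (cong suc ih)
... | antidiag | ih = trans (+-suc₃ (count horiz ls) (count vert ls) (count diag ls) _) (cong suc ih)

dominant-direction : ∀ ls → ∃[ d ] ceil4 (length ls) ≤ count d ls
dominant-direction ls = subst (λ n → ∃[ d ] ceil4 n ≤ count d ls)
  (Σ-Dir-count ls) (pigeonhole-Dir (λ d → count d ls))

claim1 : (N : ℕ) → 0 < N → (ls : List Line) → length ls ≡ N → IsLayout ls →
    5 * ceil4 N ≤ covered ls
claim1 _ _ ls refl lay with dominant-direction ls
... | d , many = begin
  5 * ceil4 (length ls) ≡⟨ *-comm 5 (ceil4 (length ls)) ⟩
  ceil4 (length ls) * 5 ≤⟨ *-monoˡ-≤ 5 many ⟩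
  count d ls * 5        ≤⟨ count*5≤covered d ls lay ⟩
  covered ls            ∎
  where open ≤-Reasoning
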